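{- For all integers $m,n\geq 0$, the lattice $\mathbf{W}(m,n)$ is extremal.
   Context: An $(m,n)$-word is a word $\mathfrak{w}=w_1w_2\cdots w_n$ of length $n$ over the alphabet $\{0,1,\dots,m+1\}$ such that (MN1) $w_1\neq m+1$, and (MN2) for every $s$ with $1\le s\le m$ and every index $i$, if $w_i=s$ then $w_j\ge s$ for all $j<i$. $\mathbf{W}(m,n)$ is the set of $(m,n)$-words ordered componentwise ($\mathfrak{u}\le\mathfrak{v}$ iff $u_i\le v_i$ for all $i$); this is a lattice. An element $j$ of a finite lattice is join-irreducible if $j=p\vee q$ implies $p=j$ or $q=j$ (the bottom element is not join-irreducible); meet-irreducible is defined dually. The length $\ell(\mathbf{P})$ of a finite lattice $\mathbf{P}$ is one less than the maximum cardinality of a chain. $\mathbf{P}$ is extremal if the number of join-irreducible elements, $\ell(\mathbf{P})$, and the number of meet-irreducible elements coincide. -}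

module Defs where

open import Data.Nat using (ℕ; zero; suc; _+_; _≤_; _<_)
open import Data.Fin using (Fin; toℕ)
open import Data.Vec using (Vec; lookup)
open import Data.List using (List; length)
open import Data.List.Membership.Propositional using (_∈_)
open import Data.List.Relation.Unary.All using (All)
open import Data.List.Relation.Unary.Unique.Propositional using (Unique)
open import Data.List.Relation.Unary.AllPairs using (AllPairs)
open import Data.Product using (Σ; ∃; _×_)
open import Data.Sum using (_⊎_)
open import Relation.Binary.PropositionalEquality using (_≡_; _≢_)
open import Function.Bundles using (_⇔_)

Word : ℕ → Set
Word n = Vec ℕ n

record IsWord (m n : ℕ) (w : Word n) : Set where
  field
    alphabet : ∀ (i : Fin n) → lookup w i ≤ suc m
    MN1      : ∀ (i : Fin n) → toℕ i ≡ 0 → lookup w i ≢ suc m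
    MN2      : ∀ (s : ℕ) → 1 ≤ s → s ≤ m → ∀ (i : Fin n) → lookup w i ≡ s →
               ∀ (j : Fin n) → toℕ j < toℕ i → s ≤ lookup w j

_≼_ : ∀ {n} → Word n → Word n → Set
u ≼ v = ∀ i → lookup u i ≤ lookup v i

module _ (m n : ℕ) where

  IsJoin : Word n → Word n → Word n → Set
  IsJoin p q j = IsWord m n j × p ≼ j × q ≼ j ×
                 (∀ u → IsWord m n u → p ≼ u → q ≼ u → j ≼ u)

  IsMeet : Word n → Word n → Word n → Set
  IsMeet p q j = IsWord m n j × j ≼ p × j ≼ q ×
                 (∀ u → IsWord m n u → u ≼ p → u ≼ q → u ≼ j)

  IsBottom : Word n → Set
  IsBottom b = IsWord m n b × (∀ u → IsWord m n u → b ≼ u)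

  IsTop : Word n → Set
  IsTop t = IsWord m n t × (∀ u → IsWord m n u → u ≼ t)

  JoinIrreducible : Word n → Set
  JoinIrreducible j = IsWord m n j × (IsBottom j → Data.Empty.⊥) ×
    (∀ p q → IsWord m n p → IsWord m n q → IsJoin p q j → p ≡ j ⊎ q ≡ j)
    where import Data.Empty

  MeetIrreducible : Word n → Set
  MeetIrreducible j = IsWord m n j × (IsTop j → Data.Empty.⊥) ×
    (∀ p q → IsWord m n p → IsWord m n q → IsMeet p q j → p ≡ j ⊎ q ≡ j)
    where import Data.Empty

  HasCount : (Word n → Set) → ℕ → Set
  HasCount P k = Σ (List (Word n)) λ L →
    Unique L × length L ≡ k × (∀ w → (w ∈ L) ⇔ P w)

  Comparable : Word n → Word n → Set
  Comparable u v = u ≼ v ⊎ v ≼ u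

  IsChain : List (Word n) → Set
  IsChain C = All (IsWord m n) C × Unique C × AllPairs Comparable C

  -- ℓ(W(m,n)) = k : max cardinality of a chain is k+1
  HasLength : ℕ → Set
  HasLength k = (Σ (List (Word n)) λ C → IsChain C × length C ≡ suc k) ×
                (∀ C → IsChain C → length C ≤ suc k)

  Extremal : Set
  Extremal = ∃ λ k → HasCount JoinIrreducible k × HasLength k ×
                     HasCount MeetIrreducible k

module Submission where

-- Every word lies below top = m (m+1) ⋯ (m+1), and the rank (sum of the letters) strictly increases
-- along the order, so a chain has at most 1 + rank(top) elements; raising the letters one at a time
-- from the left attains this bound. For each position i and each b below the ceiling of i, the least
-- word with i-th letter b+1 is join-irreducible and the greatest word with i-th letter at most b is
-- meet-irreducible, and every irreducible arises this way; so both kinds also number rank(top).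

open import Defs
open import Data.Empty using (⊥; ⊥-elim)
open import Data.Fin as Fin using (Fin; zero; suc; toℕ; fromℕ<)
open import Data.Fin.Properties as Finₚ using (_≟_; <-cmp; any?; injective⇒≤; toℕ-fromℕ<)
open import Data.List using (List; []; _∷_; length; map; _++_; upTo)
import Data.List as List
open import Data.List.Properties using (length-map; length-++; length-upTo)
open import Data.List.Membership.Propositional using (_∈_)
open import Data.List.Membership.Propositional.Properties
  using (∈-map⁺; ∈-map⁻; ∈-++⁺ˡ; ∈-++⁺ʳ; ∈-++⁻; ∈-upTo⁺; ∈-upTo⁻; ∈-lookup)
open import Data.List.Relation.Unary.All as All using (All; []; _∷_)
import Data.List.Relation.Unary.All.Properties as All
open import Data.List.Relation.Unary.AllPairs as AllPairs using (AllPairs; []; _∷_)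
import Data.List.Relation.Unary.AllPairs.Properties as AllPairs
open import Data.List.Relation.Unary.Any using (here; there)
open import Data.List.Relation.Unary.Unique.Propositional using (Unique)
import Data.List.Relation.Unary.Unique.Propositional.Properties as Unique
open import Data.Nat using (ℕ; zero; suc; _+_; _≤_; _<_; _⊔_; _⊓_; z≤n; s≤s; _≤?_; _<?_)
open import Data.Nat.Properties hiding (_≟_; <-cmp)
open import Data.Product as Product using (Σ; ∃; ∃₂; _×_; _,_; proj₂; uncurry)
open import Data.Sum using (_⊎_; inj₁; inj₂; [_,_]′)
open import Data.Vec using (Vec; []; _∷_; lookup; tabulate; replicate; zipWith; sum; _[_]≔_)
open import Data.Vec.Properties
  using (tabulate∘lookup; tabulate-cong; lookup∘tabulate; lookup-replicate; lookup-zipWith;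
         lookup∘update; lookup∘update′)
open import Function using (_∘_; id)
open import Function.Bundles using (mk⇔)
open import Relation.Binary.Definitions using (tri<; tri≈; tri>)
open import Relation.Binary.PropositionalEquality
open import Relation.Nullary using (yes; no; contradiction)

private
  variable
    A : Set
    n : ℕ
    a b c : ℕ
    i j k : Fin n
    f g : Fin n → ℕ
    u v t : Vec ℕ n
    xs : List A

-- Vectors of naturals under the componentwise order

≼-antisym : u ≼ v → v ≼ u → u ≡ v
≼-antisym {u = u} {v} u≼v v≼u = begin
  u                   ≡⟨ tabulate∘lookup u ⟨
  tabulate (lookup u) ≡⟨ tabulate-cong (λ i → ≤-antisym (u≼v i) (v≼u i)) ⟩
  tabulate (lookup v) ≡⟨ tabulate∘lookup v ⟩
  v                   ∎
  where open ≡-Reasoning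

replicate0-≼ : replicate n 0 ≼ u
replicate0-≼ k rewrite lookup-replicate k 0 = z≤n

sum-mono-≼ : u ≼ v → sum u ≤ sum v
sum-mono-≼ {u = []}    {[]}    _   = z≤n
sum-mono-≼ {u = _ ∷ u} {_ ∷ v} u≼v = +-mono-≤ (u≼v zero) (sum-mono-≼ {u = u} {v} (u≼v ∘ suc))

≼∧sum≡⇒≡ : u ≼ v → sum u ≡ sum v → u ≡ v
≼∧sum≡⇒≡ {u = []}    {[]}    _   _  = refl
≼∧sum≡⇒≡ {u = x ∷ u} {y ∷ v} u≼v eq = cong₂ _∷_ x≡y (≼∧sum≡⇒≡ {u = u} {v} (u≼v ∘ suc) tails)
  where
  x≡y : x ≡ y
  x≡y = ≤-antisym (u≼v zero) (+-cancelʳ-≤ (sum v) y x (begin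
    y + sum v ≡⟨ eq ⟨
    x + sum u ≤⟨ +-monoʳ-≤ x (sum-mono-≼ {u = u} {v} (u≼v ∘ suc)) ⟩
    x + sum v ∎))
    where open ≤-Reasoning
  tails : sum u ≡ sum v
  tails = +-cancelˡ-≡ y (sum u) (sum v) (subst (λ z → z + sum u ≡ y + sum v) x≡y eq)

lastNonzero : (w : Vec ℕ n) → (∀ k → lookup w k ≡ 0) ⊎
              ∃₂ λ i b → lookup w i ≡ suc b × (∀ {k} → i Fin.< k → lookup w k ≡ 0)
lastNonzero [] = inj₁ λ ()
lastNonzero (x ∷ w) with lastNonzero w
... | inj₂ (i , b , wᵢ≡ , after) = inj₂ (suc i , b , wᵢ≡ , λ { {suc k} (s≤s i<k) → after i<k })
... | inj₁ zeros with x
...   | zero  = inj₁ λ { zero → refl ; (suc k) → zeros k }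
...   | suc b = inj₂ (zero , b , refl , λ { {suc k} _ → zeros k })

-- Distinct lists

lookup-injective : Unique xs → ∀ i j → List.lookup xs i ≡ List.lookup xs j → i ≡ j
lookup-injective (_ ∷ _)      zero    zero    _  = refl
lookup-injective (x∉ ∷ _)     zero    (suc j) eq = contradiction eq (All.lookup x∉ (∈-lookup j))
lookup-injective (x∉ ∷ _)     (suc i) zero    eq = contradiction (sym eq) (All.lookup x∉ (∈-lookup i))
lookup-injective (_ ∷ unique) (suc i) (suc j) eq = cong suc (lookup-injective unique i j eq)

unique-bounded-length : ∀ {ns : List ℕ} → Unique ns → All (_< c) ns → length ns ≤ c
unique-bounded-length {ns = ns} unique bounded = injective⇒≤ {f = index} index-injective
  where
  index : Fin (length ns) → Fin _
  index i = fromℕ< (All.lookup bounded (∈-lookup i))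
  index-injective : ∀ {i j} → index i ≡ index j → i ≡ j
  index-injective {i} {j} eq = lookup-injective unique i j
    (trans (sym (toℕ-fromℕ< _)) (trans (cong toℕ eq) (toℕ-fromℕ< _)))

allPairs-∈ : ∀ {R : A → A → Set} → (∀ {x y} → x ∈ xs → y ∈ xs → R x y) → AllPairs R xs
allPairs-∈ {xs = []}    _ = []
allPairs-∈ {xs = _ ∷ _} R-∈ =
  All.tabulate (R-∈ (here refl) ∘ there) ∷ allPairs-∈ (λ x∈ y∈ → R-∈ (there x∈) (there y∈))

map⁺-injectiveOn : ∀ {B : Set} {h : A → B} → Unique xs →
                   (∀ {x y} → x ∈ xs → y ∈ xs → h x ≡ h y → x ≡ y) → Unique (map h xs)
map⁺-injectiveOn unique injectiveOn =
  AllPairs.map⁺ (AllPairs.zipWith (λ (x≢y , inj) → x≢y ∘ inj) (unique , allPairs-∈ injectiveOn))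

-- The rank (sum of entries) separates distinct comparable vectors,
-- so it maps a chain injectively into {0, …, sum t}.
chain-length-≤ : ∀ {C : List (Vec ℕ n)} → All (_≼ t) C → Unique C →
                 AllPairs (λ u v → u ≼ v ⊎ v ≼ u) C → length C ≤ suc (sum t)
chain-length-≤ {t = t} {C} below unique comparable = begin
  length C           ≡⟨ length-map sum C ⟨
  length (map sum C) ≤⟨ unique-bounded-length sums-unique sums-bounded ⟩
  suc (sum t)        ∎
  where
  open ≤-Reasoning
  sums-unique : Unique (map sum C)
  sums-unique = AllPairs.map⁺ (AllPairs.zipWith distinct-ranks (unique , comparable))
    where
    distinct-ranks : ∀ {u v} → u ≢ v × (u ≼ v ⊎ v ≼ u) → sum u ≢ sum v
    distinct-ranks (u≢v , inj₁ u≼v) eq = u≢v (≼∧sum≡⇒≡ u≼v eq)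
    distinct-ranks (u≢v , inj₂ v≼u) eq = u≢v (sym (≼∧sum≡⇒≡ v≼u (sym eq)))
  sums-bounded : All (_< suc (sum t)) (map sum C)
  sums-bounded = All.map⁺ (All.map (λ {u} u≼t → s≤s (sum-mono-≼ {u = u} {t} u≼t)) below)

hypograph : (Fin n → ℕ) → List (Fin n × ℕ)
hypograph {zero}  f = []
hypograph {suc n} f = map (zero ,_) (upTo (f zero)) ++ map (Product.map₁ suc) (hypograph (f ∘ suc))

length-hypograph : ∀ (f : Fin n → ℕ) → length (hypograph f) ≡ sum (tabulate f)
length-hypograph {zero}  f = refl
length-hypograph {suc n} f = begin
  length (map (zero ,_) (upTo (f zero)) ++ map (Product.map₁ suc) (hypograph (f ∘ suc)))
    ≡⟨ length-++ (map (zero ,_) (upTo (f zero))) ⟩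
  length (map (zero ,_) (upTo (f zero))) + length (map (Product.map₁ suc) (hypograph (f ∘ suc)))
    ≡⟨ cong₂ _+_ (trans (length-map _ (upTo (f zero))) (length-upTo (f zero)))
                 (trans (length-map _ (hypograph (f ∘ suc))) (length-hypograph (f ∘ suc))) ⟩
  f zero + sum (tabulate (f ∘ suc)) ∎
  where open ≡-Reasoning

∈-hypograph⁺ : b < f i → (i , b) ∈ hypograph f
∈-hypograph⁺ {i = zero}  b<f = ∈-++⁺ˡ (∈-map⁺ (zero ,_) (∈-upTo⁺ b<f))
∈-hypograph⁺ {f = f} {i = suc i} b<f =
  ∈-++⁺ʳ (map (zero ,_) (upTo (f zero))) (∈-map⁺ (Product.map₁ suc) (∈-hypograph⁺ b<f))

∈-hypograph⁻ : ∀ {n} {f : Fin n → ℕ} {i b} → (i , b) ∈ hypograph f → b < f i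
∈-hypograph⁻ {n = suc n} {f = f} mem with ∈-++⁻ (map (zero ,_) (upTo (f zero))) mem
... | inj₁ head with ∈-map⁻ (zero ,_) head
...   | _ , b∈ , refl = ∈-upTo⁻ b∈
∈-hypograph⁻ {n = suc n} {f = f} mem | inj₂ tail with ∈-map⁻ (Product.map₁ suc) tail
...   | _ , x∈ , refl = ∈-hypograph⁻ x∈

hypograph-unique : ∀ (f : Fin n → ℕ) → Unique (hypograph f)
hypograph-unique {zero}  f = []
hypograph-unique {suc n} f = Unique.++⁺
  (Unique.map⁺ (cong proj₂) (Unique.upTo⁺ (f zero)))
  (Unique.map⁺ shift-injective (hypograph-unique (f ∘ suc)))
  disjoint
  where
  shift-injective : ∀ {x y : Fin n × ℕ} → Product.map₁ suc x ≡ Product.map₁ suc y → x ≡ y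
  shift-injective refl = refl
  disjoint : ∀ {x} → x ∈ map (zero ,_) (upTo (f zero)) × x ∈ map (Product.map₁ suc) (hypograph (f ∘ suc)) →
             ⊥
  disjoint (head , tail) with ∈-map⁻ (zero ,_) head | ∈-map⁻ (Product.map₁ suc) tail
  ... | _ , _ , refl | _ , _ , ()

staircase : Fin n → (Fin n → ℕ) → ℕ → Vec ℕ n
staircase {suc n} zero    f a = a ∷ replicate n 0
staircase         (suc i) f a = f zero ∷ staircase i (f ∘ suc) a

lookup-staircase-< : ∀ f a → k Fin.< i → lookup (staircase i f a) k ≡ f k
lookup-staircase-< {k = zero}  {suc i} f a _         = refl
lookup-staircase-< {k = suc k} {suc i} f a (s≤s k<i) = lookup-staircase-< (f ∘ suc) a k<i

lookup-staircase-≡ : ∀ f a (i : Fin n) → lookup (staircase i f a) i ≡ a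
lookup-staircase-≡ f a zero    = refl
lookup-staircase-≡ f a (suc i) = lookup-staircase-≡ (f ∘ suc) a i

lookup-staircase-> : ∀ f a → i Fin.< k → lookup (staircase i f a) k ≡ 0
lookup-staircase-> {i = zero}  {suc k} f a _         = lookup-replicate k 0
lookup-staircase-> {i = suc i} {suc k} f a (s≤s i<k) = lookup-staircase-> (f ∘ suc) a i<k

staircase-≼ : i Fin.< j → a ≤ f i → staircase i f a ≼ staircase j f c
staircase-≼ {i = i} {j} {a} {f} {c} i<j a≤fᵢ k with <-cmp k i
... | tri< k<i _ _ rewrite lookup-staircase-< f a k<i | lookup-staircase-< f c (<-trans k<i i<j) = ≤-refl
... | tri≈ _ refl _ rewrite lookup-staircase-≡ f a k | lookup-staircase-< f c i<j = a≤fᵢ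
... | tri> _ _ i<k rewrite lookup-staircase-> f a i<k = z≤n

staircase-mono : a ≤ c → staircase i f a ≼ staircase i f c
staircase-mono {a} {c} {i = i} {f} a≤c k with <-cmp k i
... | tri< k<i _ _ rewrite lookup-staircase-< f a k<i | lookup-staircase-< f c k<i = ≤-refl
... | tri≈ _ refl _ rewrite lookup-staircase-≡ f a k | lookup-staircase-≡ f c k = a≤c
... | tri> _ _ i<k rewrite lookup-staircase-> f a i<k = z≤n

staircase-injective : staircase i f (suc a) ≡ staircase j g (suc b) → (i , a) ≡ (j , b)
staircase-injective {i = i} {f} {a} {j} {g} {b} eq with <-cmp i j
... | tri< i<j _ _ = contradiction (begin
        0                               ≡⟨ lookup-staircase-> f (suc a) i<j ⟨
        lookup (staircase i f (suc a)) j ≡⟨ cong (λ w → lookup w j) eq ⟩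
        lookup (staircase j g (suc b)) j ≡⟨ lookup-staircase-≡ g (suc b) j ⟩
        suc b                           ∎) 0≢1+n
  where open ≡-Reasoning
... | tri> _ _ j<i = contradiction (begin
        0                               ≡⟨ lookup-staircase-> g (suc b) j<i ⟨
        lookup (staircase j g (suc b)) i ≡⟨ cong (λ w → lookup w i) eq ⟨
        lookup (staircase i f (suc a)) i ≡⟨ lookup-staircase-≡ f (suc a) i ⟩
        suc a                           ∎) 0≢1+n
  where open ≡-Reasoning
... | tri≈ _ refl _ = cong (i ,_) (suc-injective (begin
        suc a                           ≡⟨ lookup-staircase-≡ f (suc a) i ⟨
        lookup (staircase i f (suc a)) i ≡⟨ cong (λ w → lookup w i) eq ⟩
        lookup (staircase i g (suc b)) i ≡⟨ lookup-staircase-≡ g (suc b) i ⟩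
        suc b                           ∎))
  where open ≡-Reasoning

-- The lattice W(m,n)

module Words (m : ℕ) where

  private
    variable
      w p q : Word n

  -- The largest letter allowed at each position, by (MN1) and the alphabet bound.
  ceiling : Fin n → ℕ
  ceiling zero    = m
  ceiling (suc _) = suc m

  m≤ceiling : ∀ (i : Fin n) → m ≤ ceiling i
  m≤ceiling zero    = ≤-refl
  m≤ceiling (suc _) = n≤1+n m

  ceiling≤1+m : ∀ (i : Fin n) → ceiling i ≤ suc m
  ceiling≤1+m zero    = n≤1+n m
  ceiling≤1+m (suc _) = ≤-refl

  ceiling-after : j Fin.< i → ceiling i ≡ suc m
  ceiling-after {i = suc _} _ = refl

  top : Word n
  top = tabulate ceiling

  bottom : Word n
  bottom = replicate _ 0

  Fits : Word n → Set
  Fits w = ∀ i → lookup w i ≤ ceiling i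

  -- (MN2) phrased by positions rather than by letters
  MN2′ : Word n → Set
  MN2′ w = ∀ {i j} → j Fin.< i → 0 < lookup w i → lookup w i ≤ m → lookup w i ≤ lookup w j

  isWord : Fits w → MN2′ w → IsWord m n w
  isWord {w = w} fits mn2 = record
    { alphabet = λ i → ≤-trans (fits i) (ceiling≤1+m i)
    ; MN1      = mn1
    ; MN2      = λ s 0<s s≤m i wᵢ≡s j j<i → subst (_≤ lookup w j) wᵢ≡s
                   (mn2 j<i (subst (0 <_) (sym wᵢ≡s) 0<s) (subst (_≤ m) (sym wᵢ≡s) s≤m))
    }
    where
    mn1 : ∀ i → toℕ i ≡ 0 → lookup w i ≢ suc m
    mn1 zero _ w₀≡1+m = 1+n≰n (subst (_≤ m) w₀≡1+m (fits zero))

  IsWord⇒Fits : IsWord m n w → Fits w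
  IsWord⇒Fits w-word zero    = m<1+n⇒m≤n (≤∧≢⇒< (IsWord.alphabet w-word zero) (IsWord.MN1 w-word zero refl))
  IsWord⇒Fits w-word (suc i) = IsWord.alphabet w-word (suc i)

  IsWord⇒MN2′ : IsWord m n w → MN2′ w
  IsWord⇒MN2′ {w = w} w-word {i} j<i 0<wᵢ wᵢ≤m = IsWord.MN2 w-word (lookup w i) 0<wᵢ wᵢ≤m i refl _ j<i

  IsWord⇒≼top : IsWord m n w → w ≼ top
  IsWord⇒≼top w-word k rewrite lookup∘tabulate ceiling k = IsWord⇒Fits w-word k

  isWord-top : IsWord m n (top {n})
  isWord-top = isWord (λ k → ≤-reflexive (lookup∘tabulate ceiling k)) mn2
    where
    mn2 : MN2′ top
    mn2 {k} j<k rewrite lookup∘tabulate ceiling k | ceiling-after j<k = λ _ → ⊥-elim ∘ 1+n≰n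

  isWord-bottom : IsWord m n (bottom {n})
  isWord-bottom = isWord fits mn2
    where
    fits : Fits bottom
    fits k rewrite lookup-replicate k 0 = z≤n
    mn2 : MN2′ bottom
    mn2 {k} _ rewrite lookup-replicate k 0 = λ ()

  isWord-⊔ : IsWord m n p → IsWord m n q → IsWord m n (zipWith _⊔_ p q)
  isWord-⊔ {p = p} {q} p-word q-word = isWord fits mn2
    where
    fits : Fits (zipWith _⊔_ p q)
    fits k rewrite lookup-zipWith _⊔_ k p q = ⊔-lub (IsWord⇒Fits p-word k) (IsWord⇒Fits q-word k)
    mn2 : MN2′ (zipWith _⊔_ p q)
    mn2 {k} {j} j<k rewrite lookup-zipWith _⊔_ k p q | lookup-zipWith _⊔_ j p q
      with ⊔-sel (lookup p k) (lookup q k)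
    ... | inj₁ eq rewrite eq = λ 0<pₖ pₖ≤m → ≤-trans (IsWord⇒MN2′ p-word j<k 0<pₖ pₖ≤m) (m≤m⊔n _ _)
    ... | inj₂ eq rewrite eq = λ 0<qₖ qₖ≤m → ≤-trans (IsWord⇒MN2′ q-word j<k 0<qₖ qₖ≤m) (m≤n⊔m _ _)

  -- A letter above m constrains nothing, and position 0 has nothing before it.
  isWord-raise : IsWord m n w → ∀ i → IsWord m n (w [ i ]≔ ceiling i)
  isWord-raise {w = w} w-word i = isWord fits mn2
    where
    fits : Fits (w [ i ]≔ ceiling i)
    fits k with k ≟ i
    ... | yes refl = ≤-reflexive (lookup∘update k w (ceiling k))
    ... | no k≢i rewrite lookup∘update′ k≢i w (ceiling i) = IsWord⇒Fits w-word k
    mn2 : MN2′ (w [ i ]≔ ceiling i)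
    mn2 {k} {j} j<k with k ≟ i | j ≟ i
    ... | yes refl | _ rewrite lookup∘update k w (ceiling k) | ceiling-after j<k = λ _ → ⊥-elim ∘ 1+n≰n
    ... | no k≢i | yes refl rewrite lookup∘update′ k≢i w (ceiling j) | lookup∘update j w (ceiling j) =
      λ _ wₖ≤m → ≤-trans wₖ≤m (m≤ceiling j)
    ... | no k≢i | no j≢i rewrite lookup∘update′ k≢i w (ceiling i) | lookup∘update′ j≢i w (ceiling i) =
      IsWord⇒MN2′ w-word j<k

  isWord-clear : IsWord m n w → (∀ {k} → i Fin.< k → lookup w k ≡ 0) → IsWord m n (w [ i ]≔ 0)
  isWord-clear {w = w} {i = i} w-word after = isWord fits mn2
    where
    fits : Fits (w [ i ]≔ 0)
    fits k with k ≟ i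
    ... | yes refl rewrite lookup∘update k w 0 = z≤n
    ... | no k≢i rewrite lookup∘update′ k≢i w 0 = IsWord⇒Fits w-word k
    mn2 : MN2′ (w [ i ]≔ 0)
    mn2 {k} {j} j<k with <-cmp k i
    ... | tri≈ _ refl _ rewrite lookup∘update k w 0 = λ ()
    ... | tri> _ _ i<k rewrite lookup∘update′ (Finₚ.<⇒≢ i<k ∘ sym) w 0 | after i<k = λ ()
    ... | tri< k<i _ _
      rewrite lookup∘update′ (Finₚ.<⇒≢ k<i) w 0 | lookup∘update′ (Finₚ.<⇒≢ (<-trans j<k k<i)) w 0 =
      IsWord⇒MN2′ w-word j<k

  isWord-staircase : a ≤ ceiling i → (∀ {k} → k Fin.< i → f k ≤ ceiling k) →
                     (0 < a → a ≤ m → ∀ {k} → k Fin.< i → a ≤ f k) →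
                     (∀ {j k} → j Fin.< k → k Fin.< i → 0 < f k → f k ≤ m → f k ≤ f j) →
                     IsWord m n (staircase i f a)
  isWord-staircase {a = a} {i = i} {f = f} a≤ceiling f-fits a-bounds f-mn2 = isWord fits mn2
    where
    fits : Fits (staircase i f a)
    fits k with <-cmp k i
    ... | tri< k<i _ _ rewrite lookup-staircase-< f a k<i = f-fits k<i
    ... | tri≈ _ refl _ rewrite lookup-staircase-≡ f a k = a≤ceiling
    ... | tri> _ _ i<k rewrite lookup-staircase-> f a i<k = z≤n
    mn2 : MN2′ (staircase i f a)
    mn2 {k} {j} j<k with <-cmp k i
    ... | tri< k<i _ _ rewrite lookup-staircase-< f a k<i | lookup-staircase-< f a (<-trans j<k k<i) =
      f-mn2 j<k k<i
    ... | tri≈ _ refl _ rewrite lookup-staircase-≡ f a k | lookup-staircase-< f a j<k =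
      λ 0<a a≤m → a-bounds 0<a a≤m j<k
    ... | tri> _ _ i<k rewrite lookup-staircase-> f a i<k = λ ()

  -- The componentwise maximum of two words is a word, hence their join.
  join-lookup : IsWord m n p → IsWord m n q → IsJoin m n p q w →
                ∀ k → lookup w k ≡ lookup p k ⊔ lookup q k
  join-lookup {p = p} {q} p-word q-word (_ , p≼w , q≼w , leastUpper) k = ≤-antisym
    (subst (_ ≤_) (lookup-zipWith _⊔_ k p q) (leastUpper _ (isWord-⊔ p-word q-word) p≼max q≼max k))
    (⊔-lub (p≼w k) (q≼w k))
    where
    p≼max : p ≼ zipWith _⊔_ p q
    p≼max k rewrite lookup-zipWith _⊔_ k p q = m≤m⊔n _ _
    q≼max : q ≼ zipWith _⊔_ p q
    q≼max k rewrite lookup-zipWith _⊔_ k p q = m≤n⊔m _ _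

  isJoin-⊔ : ∀ (p q : Word n) → IsWord m n w → (∀ k → lookup w k ≡ lookup p k ⊔ lookup q k) →
             IsJoin m n p q w
  isJoin-⊔ _ _ w-word w≡ = w-word
    , (λ k → subst (_ ≤_) (sym (w≡ k)) (m≤m⊔n _ _))
    , (λ k → subst (_ ≤_) (sym (w≡ k)) (m≤n⊔m _ _))
    , λ u _ p≼u q≼u k → subst (_≤ _) (sym (w≡ k)) (⊔-lub (p≼u k) (q≼u k))

  isMeet-⊓ : ∀ (p q : Word n) → IsWord m n w → (∀ k → lookup w k ≡ lookup p k ⊓ lookup q k) →
             IsMeet m n p q w
  isMeet-⊓ _ _ w-word w≡ = w-word
    , (λ k → subst (_≤ _) (sym (w≡ k)) (m⊓n≤m _ _))
    , (λ k → subst (_≤ _) (sym (w≡ k)) (m⊓n≤n _ _))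
    , λ u _ u≼p u≼q k → subst (_ ≤_) (sym (w≡ k)) (⊓-glb (u≼p k) (u≼q k))

  -- The smallest letter allowed before an occurrence of suc b: (MN2) only constrains letters 1,…,m.
  floorBefore : ℕ → ℕ
  floorBefore b with suc b ≤? m
  ... | yes _ = suc b
  ... | no _  = 0

  floorBefore-≥ : suc b ≤ m → suc b ≤ floorBefore b
  floorBefore-≥ {b} b<m with suc b ≤? m
  ... | yes _   = ≤-refl
  ... | no b≮m = contradiction b<m b≮m

  floorBefore-≤ : (suc b ≤ m → suc b ≤ c) → floorBefore b ≤ c
  floorBefore-≤ {b} bound with suc b ≤? m
  ... | yes b<m = bound b<m
  ... | no _    = z≤n

  least : Fin n → ℕ → Word n
  least i b = staircase i (λ _ → floorBefore b) (suc b)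

  isWord-least : b < ceiling i → IsWord m n (least i b)
  isWord-least b<ceiling = isWord-staircase b<ceiling
    (λ {k} _ → ≤-trans (floorBefore-≤ id) (m≤ceiling k))
    (λ _ b<m _ → floorBefore-≥ b<m)
    (λ _ _ _ _ → ≤-refl)

  least-≼ : IsWord m n p → lookup p i ≡ suc b → least i b ≼ p
  least-≼ {p = p} {i = i} {b = b} p-word pᵢ≡ k with <-cmp k i
  ... | tri< k<i _ _ rewrite lookup-staircase-< (λ _ → floorBefore b) (suc b) k<i =
    floorBefore-≤ (λ b<m → IsWord.MN2 p-word (suc b) (s≤s z≤n) b<m i pᵢ≡ k k<i)
  ... | tri≈ _ refl _ rewrite lookup-staircase-≡ (λ _ → floorBefore b) (suc b) k = ≤-reflexive (sym pᵢ≡)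
  ... | tri> _ _ i<k rewrite lookup-staircase-> (λ _ → floorBefore b) (suc b) i<k = z≤n

  least-joinIrreducible : ∀ {n b} {i : Fin n} → b < ceiling i → JoinIrreducible m n (least i b)
  least-joinIrreducible {n} {b} {i} b<ceiling = isWord-least b<ceiling , not-bottom , irreducible
    where
    letter : lookup (least i b) i ≡ suc b
    letter = lookup-staircase-≡ _ (suc b) i
    not-bottom : IsBottom m n (least i b) → ⊥
    not-bottom (_ , minimum) = n≮0 (subst₂ _≤_ letter (lookup-replicate i 0) (minimum bottom isWord-bottom i))
    attained : ∀ {p : Word n} → IsWord m n p → p ≼ least i b → lookup p i ≡ suc b → p ≡ least i b
    attained p-word p≼ pᵢ≡ = ≼-antisym p≼ (least-≼ p-word pᵢ≡)
    irreducible : ∀ p q → IsWord m n p → IsWord m n q → IsJoin m n p q (least i b) →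
                  p ≡ least i b ⊎ q ≡ least i b
    irreducible p q p-word q-word join@(_ , p≼ , q≼ , _)
      with ⊔-sel (lookup p i) (lookup q i) | trans (sym letter) (join-lookup p-word q-word join i)
    ... | inj₁ eq | 1+b≡ = inj₁ (attained p-word p≼ (sym (trans 1+b≡ eq)))
    ... | inj₂ eq | 1+b≡ = inj₂ (attained q-word q≼ (sym (trans 1+b≡ eq)))

  -- A word other than the bottom is the join of least i b, read off its last nonzero letter,
  -- and of itself with that letter cleared.
  joinIrreducible⇒least : JoinIrreducible m n w → ∃₂ λ i b → b < ceiling i × w ≡ least i b
  joinIrreducible⇒least {w = w} (w-word , not-bottom , irreducible) with lastNonzero w
  ... | inj₁ zeros = ⊥-elim (not-bottom (w-word , λ _ _ k → subst (_≤ _) (sym (zeros k)) z≤n))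
  ... | inj₂ (i , b , wᵢ≡ , after) =
    i , b , b<ceiling ,
    [ sym , cleared≢w ]′ (irreducible _ _ (isWord-least b<ceiling) (isWord-clear w-word after) join)
    where
    b<ceiling : b < ceiling i
    b<ceiling = subst (_≤ ceiling i) wᵢ≡ (IsWord⇒Fits w-word i)
    pointwise : ∀ k → lookup w k ≡ lookup (least i b) k ⊔ lookup (w [ i ]≔ 0) k
    pointwise k with k ≟ i
    ... | yes refl rewrite lookup∘update k w 0 | lookup-staircase-≡ (λ _ → floorBefore b) (suc b) k = wᵢ≡
    ... | no k≢i rewrite lookup∘update′ k≢i w 0 = sym (m≤n⇒m⊔n≡n (least-≼ w-word wᵢ≡ k))
    join : IsJoin m _ (least i b) (w [ i ]≔ 0) w
    join = isJoin-⊔ (least i b) (w [ i ]≔ 0) w-word pointwise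
    cleared≢w : w [ i ]≔ 0 ≡ w → w ≡ least i b
    cleared≢w eq = contradiction
      (trans (sym (lookup∘update i w 0)) (trans (cong (λ v → lookup v i) eq) wᵢ≡)) 0≢1+n

  greatest : Fin n → ℕ → Word n
  greatest i b = top [ i ]≔ b

  lookup-greatest-≡ : ∀ (i : Fin n) b → lookup (greatest i b) i ≡ b
  lookup-greatest-≡ i b = lookup∘update i top b

  lookup-greatest-≢ : k ≢ i → lookup (greatest i b) k ≡ ceiling k
  lookup-greatest-≢ {k = k} {i = i} {b = b} k≢i = trans (lookup∘update′ k≢i top b) (lookup∘tabulate ceiling k)

  isWord-greatest : b ≤ ceiling i → IsWord m n (greatest i b)
  isWord-greatest {b = b} {i = i} b≤ceiling = isWord fits mn2
    where
    fits : Fits (greatest i b)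
    fits k with k ≟ i
    ... | yes refl rewrite lookup-greatest-≡ k b = b≤ceiling
    ... | no k≢i rewrite lookup-greatest-≢ {b = b} k≢i = ≤-refl
    mn2 : MN2′ (greatest i b)
    mn2 {k} {j} j<k with k ≟ i
    ... | yes refl rewrite lookup-greatest-≡ k b | lookup-greatest-≢ {b = b} (Finₚ.<⇒≢ j<k) =
      λ _ b≤m → ≤-trans b≤m (m≤ceiling j)
    ... | no k≢i rewrite lookup-greatest-≢ {b = b} k≢i | ceiling-after j<k = λ _ → ⊥-elim ∘ 1+n≰n

  ≼-greatest : IsWord m n p → lookup p i ≤ b → p ≼ greatest i b
  ≼-greatest {p = p} {i = i} {b = b} p-word pᵢ≤b k with k ≟ i
  ... | yes refl rewrite lookup-greatest-≡ k b = pᵢ≤b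
  ... | no k≢i rewrite lookup-greatest-≢ {b = b} k≢i = IsWord⇒Fits p-word k

  greatest-suc-≼ : greatest i b ≼ p → b < lookup p i → greatest i (suc b) ≼ p
  greatest-suc-≼ {i = i} {b = b} g≼p b<pᵢ k with k ≟ i
  ... | yes refl rewrite lookup-greatest-≡ k (suc b) = b<pᵢ
  ... | no k≢i rewrite lookup-greatest-≢ {b = suc b} k≢i =
    subst (_≤ _) (lookup-greatest-≢ {b = b} k≢i) (g≼p k)

  greatest-meetIrreducible : ∀ {n b} {i : Fin n} → b < ceiling i → MeetIrreducible m n (greatest i b)
  greatest-meetIrreducible {n} {b} {i} b<ceiling = isWord-greatest (<⇒≤ b<ceiling) , not-top , irreducible
    where
    not-top : IsTop m n (greatest i b) → ⊥
    not-top (_ , maximum) = <⇒≱ b<ceiling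
      (subst₂ _≤_ (lookup∘tabulate ceiling i) (lookup-greatest-≡ i b) (maximum top isWord-top i))
    attained : ∀ {p : Word n} → IsWord m n p → greatest i b ≼ p → lookup p i ≤ b → p ≡ greatest i b
    attained p-word g≼p pᵢ≤b = ≼-antisym (≼-greatest p-word pᵢ≤b) g≼p
    irreducible : ∀ p q → IsWord m n p → IsWord m n q → IsMeet m n p q (greatest i b) →
                  p ≡ greatest i b ⊎ q ≡ greatest i b
    irreducible p q p-word q-word (_ , g≼p , g≼q , greatestLower) with lookup p i ≤? b | lookup q i ≤? b
    ... | yes pᵢ≤b | _        = inj₁ (attained p-word g≼p pᵢ≤b)
    ... | no _     | yes qᵢ≤b = inj₂ (attained q-word g≼q qᵢ≤b)
    ... | no pᵢ≰b  | no qᵢ≰b  = ⊥-elim (1+n≰n (subst₂ _≤_ (lookup-greatest-≡ i (suc b)) (lookup-greatest-≡ i b)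
      (greatestLower (greatest i (suc b)) (isWord-greatest b<ceiling)
        (greatest-suc-≼ {p = p} g≼p (≰⇒> pᵢ≰b)) (greatest-suc-≼ {p = q} g≼q (≰⇒> qᵢ≰b)) i)))

  -- A word other than the top is the meet of greatest i wᵢ, at a letter below its ceiling,
  -- and of itself with that letter raised.
  meetIrreducible⇒greatest : MeetIrreducible m n w → ∃₂ λ i b → b < ceiling i × w ≡ greatest i b
  meetIrreducible⇒greatest {w = w} (w-word , not-top , irreducible) with any? (λ i → lookup w i <? ceiling i)
  ... | no none = ⊥-elim (not-top (w-word , λ u u-word k →
          ≤-trans (IsWord⇒Fits u-word k) (≮⇒≥ (λ wₖ<ceiling → none (k , wₖ<ceiling)))))
  ... | yes (i , wᵢ<ceiling) =
    i , lookup w i , wᵢ<ceiling ,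
    [ sym , raised≢w ]′ (irreducible _ _ (isWord-greatest (<⇒≤ wᵢ<ceiling)) (isWord-raise w-word i) meet)
    where
    pointwise : ∀ k → lookup w k ≡ lookup (greatest i (lookup w i)) k ⊓ lookup (w [ i ]≔ ceiling i) k
    pointwise k with k ≟ i
    ... | yes refl rewrite lookup-greatest-≡ k (lookup w k) | lookup∘update k w (ceiling k) =
      sym (m≤n⇒m⊓n≡m (IsWord⇒Fits w-word k))
    ... | no k≢i rewrite lookup-greatest-≢ {b = lookup w i} k≢i | lookup∘update′ k≢i w (ceiling i) =
      sym (m≥n⇒m⊓n≡n (IsWord⇒Fits w-word k))
    meet : IsMeet m _ (greatest i (lookup w i)) (w [ i ]≔ ceiling i) w
    meet = isMeet-⊓ (greatest i (lookup w i)) (w [ i ]≔ ceiling i) w-word pointwise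
    raised≢w : w [ i ]≔ ceiling i ≡ w → w ≡ greatest i (lookup w i)
    raised≢w eq = contradiction
      (trans (cong (λ v → lookup v i) (sym eq)) (lookup∘update i w (ceiling i))) (<⇒≢ wᵢ<ceiling)

  greatest-injective : b < ceiling i → greatest i b ≡ greatest j c → (i , b) ≡ (j , c)
  greatest-injective {b = b} {i = i} {j = j} {c = c} b<ceiling eq with i ≟ j
  ... | yes refl = cong (i ,_)
    (trans (sym (lookup-greatest-≡ i b)) (trans (cong (λ v → lookup v i) eq) (lookup-greatest-≡ i c)))
  ... | no i≢j = contradiction
    (trans (sym (lookup-greatest-≡ i b)) (trans (cong (λ v → lookup v i) eq) (lookup-greatest-≢ i≢j))) (<⇒≢ b<ceiling)

  step : Fin n → ℕ → Word n
  step i b = staircase i ceiling (suc b)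

  isWord-step : b < ceiling i → IsWord m n (step i b)
  isWord-step b<ceiling = isWord-staircase b<ceiling (λ _ → ≤-refl)
    (λ _ b<m {k} _ → ≤-trans b<m (m≤ceiling k))
    (λ j<k _ _ ceilingₖ≤m → ⊥-elim (1+n≰n (subst (_≤ m) (ceiling-after j<k) ceilingₖ≤m)))

  step-comparable : b < ceiling i → c < ceiling j → Comparable m n (step i b) (step j c)
  step-comparable {b = b} {i = i} {c = c} {j = j} b<ceiling c<ceiling with <-cmp i j
  ... | tri< i<j _ _  = inj₁ (staircase-≼ {f = ceiling} i<j b<ceiling)
  ... | tri> _ _ j<i  = inj₂ (staircase-≼ {f = ceiling} j<i c<ceiling)
  ... | tri≈ _ refl _ = [ inj₁ ∘ mono , inj₂ ∘ mono ]′ (≤-total b c)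
    where
    mono : ∀ {a a′} → a ≤ a′ → step i a ≼ step i a′
    mono = staircase-mono {i = i} {f = ceiling} ∘ s≤s

  bottom≢step : bottom ≢ step i b
  bottom≢step {i = i} {b = b} eq = 0≢1+n (begin
    0                      ≡⟨ lookup-replicate i 0 ⟨
    lookup bottom i        ≡⟨ cong (λ v → lookup v i) eq ⟩
    lookup (step i b) i    ≡⟨ lookup-staircase-≡ ceiling (suc b) i ⟩
    suc b                  ∎)
    where open ≡-Reasoning

  keys : List (Fin n × ℕ)
  keys = hypograph ceiling

  ∈-keys : ∀ {h : Fin n → ℕ → Word n} → (∃₂ λ i b → b < ceiling i × w ≡ h i b) →
           ∃ λ x → x ∈ keys × w ≡ uncurry h x
  ∈-keys (i , b , b<ceiling , w≡) = (i , b) , ∈-hypograph⁺ b<ceiling , w≡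

  hasCount-image : ∀ {P : Word n → Set} (h : A → Word n) → Unique xs →
                   (∀ {x y} → x ∈ xs → y ∈ xs → h x ≡ h y → x ≡ y) →
                   (∀ {x} → x ∈ xs → P (h x)) → (∀ {w} → P w → ∃ λ x → x ∈ xs × w ≡ h x) →
                   HasCount m n P (length xs)
  hasCount-image {xs = xs} {P = P} h unique injectiveOn image-P P-image =
    map h xs , map⁺-injectiveOn unique injectiveOn , length-map h xs ,
    λ w → mk⇔ (from-image w) (∈-image ∘ P-image)
    where
    from-image : ∀ w → w ∈ map h xs → P w
    from-image w w∈ with ∈-map⁻ h w∈
    ... | _ , x∈ , refl = image-P x∈
    ∈-image : ∀ {w} → (∃ λ x → x ∈ xs × w ≡ h x) → w ∈ map h xs
    ∈-image (_ , x∈ , refl) = ∈-map⁺ h x∈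

  joinIrreducible-count : HasCount m n (JoinIrreducible m n) (length (keys {n}))
  joinIrreducible-count = hasCount-image (uncurry least) (hypograph-unique ceiling)
    (λ _ _ → staircase-injective)
    (least-joinIrreducible ∘ ∈-hypograph⁻)
    (∈-keys ∘ joinIrreducible⇒least)

  meetIrreducible-count : HasCount m n (MeetIrreducible m n) (length (keys {n}))
  meetIrreducible-count = hasCount-image (uncurry greatest) (hypograph-unique ceiling)
    (λ x∈ _ → greatest-injective (∈-hypograph⁻ x∈))
    (greatest-meetIrreducible ∘ ∈-hypograph⁻)
    (∈-keys ∘ meetIrreducible⇒greatest)

  longest-chain : ∀ {n} → Σ (List (Word n)) λ C → IsChain m n C × length C ≡ suc (length (keys {n}))
  longest-chain {n} =
    bottom ∷ map (uncurry step) keys , (words , distinct , comparable) ,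
    cong suc (length-map (uncurry step) (keys {n}))
    where
    words : All (IsWord m _) (bottom ∷ map (uncurry step) keys)
    words = isWord-bottom ∷ All.map⁺ (All.tabulate (isWord-step ∘ ∈-hypograph⁻))
    distinct : Unique (bottom ∷ map (uncurry step) keys)
    distinct = All.map⁺ (All.tabulate (λ _ → bottom≢step))
             ∷ map⁺-injectiveOn (hypograph-unique ceiling) (λ _ _ → staircase-injective)
    comparable : AllPairs (Comparable m _) (bottom ∷ map (uncurry step) keys)
    comparable = All.tabulate (λ {v} _ → inj₁ (replicate0-≼ {u = v}))
               ∷ AllPairs.map⁺ (allPairs-∈ λ x∈ y∈ → step-comparable (∈-hypograph⁻ x∈) (∈-hypograph⁻ y∈))

  chain-bound : ∀ {n} C → IsChain m n C → length C ≤ suc (length (keys {n}))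
  chain-bound {n} C (words , distinct , comparable) rewrite length-hypograph (ceiling {n}) =
    chain-length-≤ {t = top} (All.map IsWord⇒≼top words) distinct comparable

theorem4p7 : (m n : ℕ) → Extremal m n
theorem4p7 m n = length (keys {n}) , joinIrreducible-count , (longest-chain , chain-bound) , meetIrreducible-count
  where open Words m
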